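{- Let $\pi$ be a nonsingular bilinear mapping $V_n\times V_n\to V_n$, $g\in\mathcal{F}_n$, $\varphi\in\mathcal{F}_{2n}$ such that all restrictions of $\varphi(\vec u,\vec v)$ to $\vec u$ (for fixed $\vec v$) and to $\vec v$ (for fixed $\vec u$) are affine functions, and let $h,h'\in\mathcal{F}_n$ be such that $\widehat{h}(\vec{0})=\widehat{h'}(\vec{0})$, $\widehat{h}(\vec{u})=\chi(\varphi(\vec{u},\vec{0}))\widehat{g}(\vec{0})$ and $\widehat{h'}(\vec{v})=\chi(\varphi(\vec{0},\vec{v}))\widehat{g}(\vec{0})$ for all $\vec{u},\vec{v}\in V_n\setminus\{\vec{0}\}$. Then the square $S(\vec{u},\vec{v})=\widehat{h}(\vec{0})$ if $\vec{u}=\vec{v}=\vec{0}$, and $S(\vec{u},\vec{v})=\chi(\varphi(\vec{u},\vec{v}))\widehat{g}(\pi(\vec{u},\vec{v}))$ otherwise, is a bent square, i.e. for each fixed $\vec u$ the map $\vec v\mapsto S(\vec u,\vec v)$ and for each fixed $\vec v$ the map $\vec u\mapsto S(\vec u,\vec v)$ are Walsh–Hadamard transforms of functions in $\mathcal F_n$ (equivalently, $S$ is the rectangle $R_f(\vec u,\vec v)=\sum_{\vec y\in V_n}\chi(f(\vec u,\vec y))\overline{\chi(\vec v\cdot\vec y)}$ of some regular bent function $f\in\mathcal F_{2n}$).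
   Context: Let $q\ge2$, $\mathbb{Z}_q$ the integers modulo $q$, $\chi(a)=\exp(2\pi i a/q)$, $V_n=\mathbb{Z}_q^n$, $\mathcal{F}_n$ the set of functions $V_n\to\mathbb{Z}_q$, and for $g\in\mathcal F_n$ let $\widehat{g}(\vec{u})=\sum_{\vec{x}\in V_n}\chi(g(\vec{x}))\overline{\chi(\vec{u}\cdot\vec{x})}$. A mapping $\pi\colon V_n\times V_n\to V_n$ is bilinear if all its restrictions $\vec u\mapsto\pi(\vec u,\vec v)$ (fixed $\vec v$) and $\vec v\mapsto\pi(\vec u,\vec v)$ (fixed $\vec u$) are linear transformations of $V_n$; it is nonsingular if the restrictions to $\vec u$ for $\vec v\ne\vec0$ and to $\vec v$ for $\vec u\neq\vec0$ are invertible. A function $f\in\mathcal F_m$ is regular bent if $\widehat f(\vec u)\in q^{m/2}\{\zeta:\zeta^q=1\}$ for all $\vec u$. -}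

module Defs where

open import Data.Nat as ℕ using (ℕ; zero; suc; NonZero)
open import Data.Nat.Divisibility using (_∣?_)
open import Data.Nat.DivMod using (_mod_; _/_)
open import Data.Nat.Primality using (prime?)
open import Data.Fin as Fin using (Fin; toℕ)
open import Data.Fin.Properties using () renaming (_≟_ to _≟F_)
open import Data.Integer as ℤ using (ℤ)
open import Data.List as List using (List; []; _∷_; foldr; filter; concatMap; upTo; allFin)
open import Data.Vec as Vec using (Vec; []; _∷_; _++_; zipWith; replicate)
open import Data.Vec.Properties using (≡-dec)
open import Data.Product using (Σ; _×_; _,_)
open import Relation.Nullary using (¬_; yes; no; _×-dec_)
open import Relation.Binary.PropositionalEquality using (_≡_)

module _ (q : ℕ) .{{_ : NonZero q}} where

  Zq : Set
  Zq = Fin q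

  infixl 6 _+q_ _-q_
  infixl 7 _*q_

  _+q_ : Zq → Zq → Zq
  a +q b = (toℕ a ℕ.+ toℕ b) mod q

  _*q_ : Zq → Zq → Zq
  a *q b = (toℕ a ℕ.* toℕ b) mod q

  -q_ : Zq → Zq
  -q a = (q ℕ.∸ toℕ a) mod q

  _-q_ : Zq → Zq → Zq
  a -q b = a +q (-q b)

  0q : Zq
  0q = 0 mod q

  V : ℕ → Set
  V n = Vec Zq n

  F : ℕ → Set
  F n = V n → Zq

  0v : ∀ {n} → V n
  0v = replicate _ 0q

  _+v_ : ∀ {n} → V n → V n → V n
  _+v_ = zipWith _+q_

  _·v_ : ∀ {n} → Zq → V n → V n
  c ·v x = Vec.map (c *q_) x

  dot : ∀ {n} → V n → V n → Zq
  dot u x = Vec.foldr _ _+q_ 0q (zipWith _*q_ u x)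

  allV : ∀ n → List (V n)
  allV zero    = [] ∷ []
  allV (suc n) = concatMap (λ a → List.map (a ∷_) (allV n)) (allFin q)

  -- ℤ[ζ_q] ⊂ ℂ, ζ = exp(2πi/q), modelled by the group ring ℤ[ℤ_q]:
  -- c : Zq → ℤ stands for the complex number Σ_a c(a) ζ^a.
  C : Set
  C = Zq → ℤ

  0C : C
  0C _ = ℤ.0ℤ

  _+C_ : C → C → C
  (c +C d) a = c a ℤ.+ d a

  _-C_ : C → C → C
  (c -C d) a = c a ℤ.- d a

  sumZ : List ℤ → ℤ
  sumZ = foldr ℤ._+_ ℤ.0ℤ

  -- product (convolution): ζ^a ζ^b = ζ^(a+b)
  _*C_ : C → C → C
  (c *C d) a = sumZ (List.map (λ b → c b ℤ.* d (a -q b)) (allFin q))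

  -- complex conjugation: conj(ζ^a) = ζ^(-a)
  conj : C → C
  conj c a = c (-q a)

  -- χ(a) = exp(2πi a/q) = ζ^a
  χ : Zq → C
  χ a b with a ≟F b
  ... | yes _ = ℤ.1ℤ
  ... | no  _ = ℤ.0ℤ

  sumC : List C → C
  sumC = foldr _+C_ 0C

  -- Equality of the represented complex numbers.
  -- Σ_a c(a) ζ^a = 0 in ℂ  iff  c · Π_{p prime, p ∣ q} (x^(q/p) − 1) = 0 in ℤ[x]/(x^q − 1)
  -- (by the CRT decomposition ℚ[x]/(x^q−1) ≅ Π_{d∣q} ℚ(ζ_d)).
  primesDividing : List ℕ
  primesDividing = filter (λ p → prime? p ×-dec (p ∣? q)) (upTo (suc q))

  -- multiplication by (x^k − 1)
  shiftDiff : ℕ → C → C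
  shiftDiff k c a = c (a -q (k mod q)) ℤ.- c a

  -- q/p (p is a prime, so the zero case never occurs)
  cofactor : ℕ → ℕ
  cofactor zero    = zero
  cofactor (suc p) = q / suc p

  IsZeroC : C → Set
  IsZeroC c = ∀ a → foldr (λ p d → shiftDiff (cofactor p) d) c primesDividing a ≡ ℤ.0ℤ

  infix 4 _≈C_
  _≈C_ : C → C → Set
  c ≈C d = IsZeroC (c -C d)

  wht : ∀ {n} → F n → V n → C
  wht {n} g u = sumC (List.map (λ x → χ (g x) *C conj (χ (dot u x))) (allV n))

  Linear : ∀ {n} → (V n → V n) → Set
  Linear L = (∀ x y → L (x +v y) ≡ L x +v L y) × (∀ c x → L (c ·v x) ≡ c ·v L x)

  Invertible : ∀ {n} → (V n → V n) → Set
  Invertible {n} L = Σ (V n → V n) λ M → (∀ x → M (L x) ≡ x) × (∀ y → L (M y) ≡ y)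

  Bilinear : ∀ {n} → (V n → V n → V n) → Set
  Bilinear π = (∀ v → Linear (λ u → π u v)) × (∀ u → Linear (λ v → π u v))

  Nonsingular : ∀ {n} → (V n → V n → V n) → Set
  Nonsingular π = (∀ v → ¬ (v ≡ 0v) → Invertible (λ u → π u v))
                × (∀ u → ¬ (u ≡ 0v) → Invertible (λ v → π u v))

  Affine : ∀ {n} → (V n → Zq) → Set
  Affine {n} ψ = Σ (V n) λ w → Σ Zq λ c → ∀ x → ψ x ≡ dot w x +q c

  app2 : ∀ {n} → F (n ℕ.+ n) → V n → V n → Zq
  app2 φ u v = φ (u ++ v)

  SectionsAffine : ∀ {n} → F (n ℕ.+ n) → Set
  SectionsAffine {n} φ = (∀ v → Affine (λ u → app2 {n} φ u v)) × (∀ u → Affine (λ v → app2 {n} φ u v))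

  Sq : ∀ {n} → (V n → V n → V n) → F n → F (n ℕ.+ n) → F n → V n → V n → C
  Sq π g φ h u v with ≡-dec _≟F_ u 0v | ≡-dec _≟F_ v 0v
  ... | yes _ | yes _ = wht h 0v
  ... | _     | _     = χ (app2 φ u v) *C wht g (π u v)

  BentSquare : ∀ {n} → (V n → V n → C) → Set
  BentSquare {n} S = (∀ u → Σ (F n) λ f → ∀ v → S u v ≈C wht f v)
                   × (∀ v → Σ (F n) λ f → ∀ u → S u v ≈C wht f u)

  EqC : C → C → Set
  EqC = _≈C_

  mulC : C → C → C
  mulC = _*C_

module Submission where

-- In a row u ≠ 0 the map
-- L = π(u,·) is linear and invertible and φ(u,·) = w·v + c is affine; the key fact
-- (twisted-transform) is that  χ(w·v + c) ĝ(L v) = f̂(v)  for  f(y) = g((L⁻¹)*(y + w)) + c.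
-- Comparing coefficients of ζ^t, both sides count the solutions x of an equation
-- g(x) − (frequency)·x = (constant), and the change of variables x = (L⁻¹)*(y + w)
-- matches the two counts. The row u = 0 is the transform of h′ by hypothesis, because
-- π(0,v) = 0; columns are symmetric, with h in place of h′.

open import Defs
open import Data.Nat as ℕ using (ℕ; zero; suc; NonZero; _%_; _≤_; _+_)
import Data.Nat.Properties as ℕP
open import Data.Nat.DivMod using (_mod_; %-distribˡ-+; %-distribˡ-*; m%n%n≡m%n; m<n⇒m%n≡m; n%n≡0)
open import Data.Fin as Fin using (Fin; toℕ)
open import Data.Fin.Properties using (toℕ-fromℕ<; toℕ-injective; toℕ<n; suc-injective) renaming (_≟_ to _≟F_)
open import Data.Integer using (ℤ; 0ℤ; 1ℤ) renaming (_+_ to _+ℤ_; _*_ to _*ℤ_; _-_ to _-ℤ_; -_ to -ℤ_)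
import Data.Integer.Properties as ℤP
open import Data.List as List using (List; []; _∷_; _++_; allFin; tabulate; concatMap)
open import Data.Vec as Vec using ([]; _∷_)
open import Data.Vec.Properties using (≡-dec; ∷-injective)
open import Data.Product using (Σ; _×_; _,_; proj₁; proj₂)
open import Data.Sum using (_⊎_; inj₁; inj₂)
open import Data.Empty using (⊥-elim)
open import Relation.Nullary using (Dec; yes; no; ¬_)
open import Relation.Binary.Definitions using (DecidableEquality)
open import Relation.Binary.PropositionalEquality
open import Algebra.Bundles using (CommutativeRing)
open import Function using (_∘_; id)
import Algebra.Properties.CommutativeSemigroup as CommSemigroupProperties
import Algebra.Properties.AbelianGroup as AbelianGroupProperties
import Algebra.Solver.CommutativeMonoid as CommMonoidSolver

private
  module ℤ+ = CommSemigroupProperties ℤP.+-commutativeSemigroup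
  module ℤ+ᵍ = AbelianGroupProperties ℤP.+-0-abelianGroup

∑ : {A : Set} → List A → (A → ℤ) → ℤ
∑ []       G = 0ℤ
∑ (x ∷ xs) G = G x +ℤ ∑ xs G

∑-cong : {A : Set} (xs : List A) {G H : A → ℤ} → (∀ x → G x ≡ H x) → ∑ xs G ≡ ∑ xs H
∑-cong []       G≗H = refl
∑-cong (x ∷ xs) G≗H = cong₂ _+ℤ_ (G≗H x) (∑-cong xs G≗H)

∑-zero : {A : Set} (xs : List A) {G : A → ℤ} → (∀ x → G x ≡ 0ℤ) → ∑ xs G ≡ 0ℤ
∑-zero []       G≗0 = refl
∑-zero (x ∷ xs) G≗0 = cong₂ _+ℤ_ (G≗0 x) (∑-zero xs G≗0)

∑-+ : {A : Set} (xs : List A) (G H : A → ℤ) → ∑ xs (λ x → G x +ℤ H x) ≡ ∑ xs G +ℤ ∑ xs H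
∑-+ []       G H = refl
∑-+ (x ∷ xs) G H = trans (cong (G x +ℤ H x +ℤ_) (∑-+ xs G H)) (ℤ+.interchange (G x) (H x) (∑ xs G) (∑ xs H))

∑-*ˡ : {A : Set} (xs : List A) (c : ℤ) (G : A → ℤ) → ∑ xs (λ x → c *ℤ G x) ≡ c *ℤ ∑ xs G
∑-*ˡ []       c G = sym (ℤP.*-zeroʳ c)
∑-*ˡ (x ∷ xs) c G = trans (cong (c *ℤ G x +ℤ_) (∑-*ˡ xs c G)) (sym (ℤP.*-distribˡ-+ c (G x) (∑ xs G)))

∑-++ : {A : Set} (xs ys : List A) (G : A → ℤ) → ∑ (xs ++ ys) G ≡ ∑ xs G +ℤ ∑ ys G
∑-++ []       ys G = sym (ℤP.+-identityˡ (∑ ys G))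
∑-++ (x ∷ xs) ys G = trans (cong (G x +ℤ_) (∑-++ xs ys G)) (sym (ℤP.+-assoc (G x) (∑ xs G) (∑ ys G)))

∑-map : {A B : Set} (f : A → B) (xs : List A) (G : B → ℤ) → ∑ (List.map f xs) G ≡ ∑ xs (λ x → G (f x))
∑-map f []       G = refl
∑-map f (x ∷ xs) G = cong (G (f x) +ℤ_) (∑-map f xs G)

∑-concatMap : {A B : Set} (f : A → List B) (xs : List A) (G : B → ℤ) →
              ∑ (concatMap f xs) G ≡ ∑ xs (λ x → ∑ (f x) G)
∑-concatMap f []       G = refl
∑-concatMap f (x ∷ xs) G = trans (∑-++ (f x) (concatMap f xs) G) (cong (∑ (f x) G +ℤ_) (∑-concatMap f xs G))

∑-swap : {A B : Set} (xs : List A) (ys : List B) (H : A → B → ℤ) →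
         ∑ xs (λ x → ∑ ys (H x)) ≡ ∑ ys (λ y → ∑ xs (λ x → H x y))
∑-swap []       ys H = sym (∑-zero ys (λ _ → refl))
∑-swap (x ∷ xs) ys H = trans (cong (∑ ys (H x) +ℤ_) (∑-swap xs ys H)) (sym (∑-+ ys (H x) (λ y → ∑ xs (λ x′ → H x′ y))))

∑-tabulate-cong : {A B : Set} {m : ℕ} (f : Fin m → A) (g : Fin m → B) {G : A → ℤ} {H : B → ℤ} →
                  (∀ i → G (f i) ≡ H (g i)) → ∑ (tabulate f) G ≡ ∑ (tabulate g) H
∑-tabulate-cong {m = zero}  f g eq = refl
∑-tabulate-cong {m = suc m} f g eq = cong₂ _+ℤ_ (eq Fin.zero) (∑-tabulate-cong (f ∘ Fin.suc) (g ∘ Fin.suc) (eq ∘ Fin.suc))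

δ : {A : Set} → DecidableEquality A → A → A → ℤ
δ _≟_ a b with a ≟ b
... | yes _ = 1ℤ
... | no  _ = 0ℤ

δ-≡ : {A : Set} (_≟_ : DecidableEquality A) {a b : A} → a ≡ b → δ _≟_ a b ≡ 1ℤ
δ-≡ _≟_ {a} {b} a≡b with a ≟ b
... | yes _   = refl
... | no  a≢b = ⊥-elim (a≢b a≡b)

δ-≢ : {A : Set} (_≟_ : DecidableEquality A) {a b : A} → ¬ a ≡ b → δ _≟_ a b ≡ 0ℤ
δ-≢ _≟_ {a} {b} a≢b with a ≟ b
... | yes a≡b = ⊥-elim (a≢b a≡b)
... | no  _   = refl

δ-⇔ : {A B : Set} (_≟A_ : DecidableEquality A) (_≟B_ : DecidableEquality B) {a a′ : A} {b b′ : B} →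
      (a ≡ a′ → b ≡ b′) → (b ≡ b′ → a ≡ a′) → δ _≟A_ a a′ ≡ δ _≟B_ b b′
δ-⇔ _≟A_ _≟B_ {a} {a′} to from with a ≟A a′
... | yes a≡a′ = sym (δ-≡ _≟B_ (to a≡a′))
... | no  a≢a′ = sym (δ-≢ _≟B_ (λ b≡b′ → a≢a′ (from b≡b′)))

sift-Fin : {m : ℕ} (a : Fin m) (K : Fin m → ℤ) → ∑ (allFin m) (λ b → δ _≟F_ a b *ℤ K b) ≡ K a
sift-Fin {suc m} Fin.zero K = begin
  δ _≟F_ zero₀ zero₀ *ℤ K zero₀ +ℤ ∑ (tabulate Fin.suc) (λ b → δ _≟F_ zero₀ b *ℤ K b)
    ≡⟨ cong₂ _+ℤ_ (cong (_*ℤ K zero₀) (δ-≡ _≟F_ {zero₀} refl))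
                  (trans (∑-tabulate-cong {m = m} Fin.suc id (λ _ → refl)) (∑-zero (allFin m) others-vanish)) ⟩
  1ℤ *ℤ K zero₀ +ℤ 0ℤ
    ≡⟨ trans (ℤP.+-identityʳ _) (ℤP.*-identityˡ (K zero₀)) ⟩
  K zero₀ ∎
  where
  open ≡-Reasoning
  zero₀ : Fin (suc m)
  zero₀ = Fin.zero
  others-vanish : ∀ b → δ _≟F_ zero₀ (Fin.suc b) *ℤ K (Fin.suc b) ≡ 0ℤ
  others-vanish b = trans (cong (_*ℤ K (Fin.suc b)) (δ-≢ _≟F_ {zero₀} {Fin.suc b} (λ ()))) (ℤP.*-zeroˡ (K (Fin.suc b)))
sift-Fin {suc m} (Fin.suc a) K = begin
  δ _≟F_ (Fin.suc a) Fin.zero *ℤ K Fin.zero +ℤ ∑ (tabulate Fin.suc) (λ b → δ _≟F_ (Fin.suc a) b *ℤ K b)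
    ≡⟨ cong₂ _+ℤ_ head-vanishes (∑-tabulate-cong Fin.suc id {H = λ b → δ _≟F_ a b *ℤ K (Fin.suc b)} shift) ⟩
  0ℤ +ℤ ∑ (allFin m) (λ b → δ _≟F_ a b *ℤ K (Fin.suc b))
    ≡⟨ ℤP.+-identityˡ _ ⟩
  ∑ (allFin m) (λ b → δ _≟F_ a b *ℤ K (Fin.suc b))
    ≡⟨ sift-Fin a (K ∘ Fin.suc) ⟩
  K (Fin.suc a) ∎
  where
  open ≡-Reasoning
  head-vanishes : δ _≟F_ (Fin.suc a) Fin.zero *ℤ K Fin.zero ≡ 0ℤ
  head-vanishes = trans (cong (_*ℤ K Fin.zero) (δ-≢ _≟F_ {Fin.suc a} {Fin.zero} (λ ()))) (ℤP.*-zeroˡ (K Fin.zero))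
  shift : ∀ b → δ _≟F_ (Fin.suc a) (Fin.suc b) *ℤ K (Fin.suc b) ≡ δ _≟F_ a b *ℤ K (Fin.suc b)
  shift b = cong (_*ℤ K (Fin.suc b)) (δ-⇔ _≟F_ _≟F_ {Fin.suc a} {Fin.suc b} {a} {b} suc-injective (cong Fin.suc))

module _ (q : ℕ) .{{_ : NonZero q}} where

  private
    infix  8 -_
    infixl 6 _⊕_ _⊖_
    infixl 7 _⊗_
    _⊕_ : Zq q → Zq q → Zq q
    _⊕_ = _+q_ q
    _⊗_ : Zq q → Zq q → Zq q
    _⊗_ = _*q_ q
    -_ : Zq q → Zq q
    -_ = -q_ q
    _⊖_ : Zq q → Zq q → Zq q
    _⊖_ = _-q_ q
    𝟘 : Zq q
    𝟘 = 0q q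
    𝟙 : Zq q
    𝟙 = 1 mod q
    T : Zq q → ℕ
    T = toℕ

  toℕ-mod : ∀ m → toℕ (m mod q) ≡ m % q
  toℕ-mod m = toℕ-fromℕ< _

  mod-cong : ∀ {m n} → m % q ≡ n % q → m mod q ≡ n mod q
  mod-cong {m} {n} e = toℕ-injective (trans (toℕ-mod m) (trans e (sym (toℕ-mod n))))

  %-absorbˡ-+ : ∀ m n → (m % q ℕ.+ n) % q ≡ (m ℕ.+ n) % q
  %-absorbˡ-+ m n = begin
    (m % q ℕ.+ n) % q              ≡⟨ %-distribˡ-+ (m % q) n q ⟩
    (m % q % q ℕ.+ n % q) % q      ≡⟨ cong (λ r → (r ℕ.+ n % q) % q) (m%n%n≡m%n m q) ⟩
    (m % q ℕ.+ n % q) % q          ≡⟨ %-distribˡ-+ m n q ⟨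
    (m ℕ.+ n) % q                  ∎
    where open ≡-Reasoning

  %-absorbʳ-+ : ∀ m n → (m ℕ.+ n % q) % q ≡ (m ℕ.+ n) % q
  %-absorbʳ-+ m n = begin
    (m ℕ.+ n % q) % q  ≡⟨ cong (_% q) (ℕP.+-comm m (n % q)) ⟩
    (n % q ℕ.+ m) % q  ≡⟨ %-absorbˡ-+ n m ⟩
    (n ℕ.+ m) % q      ≡⟨ cong (_% q) (ℕP.+-comm n m) ⟩
    (m ℕ.+ n) % q      ∎
    where open ≡-Reasoning

  %-absorbˡ-* : ∀ m n → (m % q ℕ.* n) % q ≡ (m ℕ.* n) % q
  %-absorbˡ-* m n = begin
    (m % q ℕ.* n) % q              ≡⟨ %-distribˡ-* (m % q) n q ⟩
    (m % q % q ℕ.* (n % q)) % q    ≡⟨ cong (λ r → (r ℕ.* (n % q)) % q) (m%n%n≡m%n m q) ⟩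
    (m % q ℕ.* (n % q)) % q        ≡⟨ %-distribˡ-* m n q ⟨
    (m ℕ.* n) % q                  ∎
    where open ≡-Reasoning

  %-absorbʳ-* : ∀ m n → (m ℕ.* (n % q)) % q ≡ (m ℕ.* n) % q
  %-absorbʳ-* m n = begin
    (m ℕ.* (n % q)) % q  ≡⟨ cong (_% q) (ℕP.*-comm m (n % q)) ⟩
    (n % q ℕ.* m) % q    ≡⟨ %-absorbˡ-* n m ⟩
    (n ℕ.* m) % q        ≡⟨ cong (_% q) (ℕP.*-comm n m) ⟩
    (m ℕ.* n) % q        ∎
    where open ≡-Reasoning

  mod-toℕ : ∀ a → T a mod q ≡ a
  mod-toℕ a = toℕ-injective (trans (toℕ-mod (T a)) (m<n⇒m%n≡m (toℕ<n a)))

  +q-assoc : ∀ a b c → (a ⊕ b) ⊕ c ≡ a ⊕ (b ⊕ c)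
  +q-assoc a b c = mod-cong (begin
    (T (a ⊕ b) ℕ.+ T c) % q        ≡⟨ cong (λ r → (r ℕ.+ T c) % q) (toℕ-mod _) ⟩
    ((T a ℕ.+ T b) % q ℕ.+ T c) % q ≡⟨ %-absorbˡ-+ _ _ ⟩
    (T a ℕ.+ T b ℕ.+ T c) % q      ≡⟨ cong (_% q) (ℕP.+-assoc (T a) _ _) ⟩
    (T a ℕ.+ (T b ℕ.+ T c)) % q    ≡⟨ %-absorbʳ-+ _ _ ⟨
    (T a ℕ.+ (T b ℕ.+ T c) % q) % q ≡⟨ cong (λ r → (T a ℕ.+ r) % q) (toℕ-mod _) ⟨
    (T a ℕ.+ T (b ⊕ c)) % q        ∎)
    where open ≡-Reasoning

  *q-assoc : ∀ a b c → (a ⊗ b) ⊗ c ≡ a ⊗ (b ⊗ c)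
  *q-assoc a b c = mod-cong (begin
    (T (a ⊗ b) ℕ.* T c) % q         ≡⟨ cong (λ r → (r ℕ.* T c) % q) (toℕ-mod _) ⟩
    ((T a ℕ.* T b) % q ℕ.* T c) % q ≡⟨ %-absorbˡ-* _ _ ⟩
    (T a ℕ.* T b ℕ.* T c) % q       ≡⟨ cong (_% q) (ℕP.*-assoc (T a) _ _) ⟩
    (T a ℕ.* (T b ℕ.* T c)) % q     ≡⟨ %-absorbʳ-* (T a) _ ⟨
    (T a ℕ.* ((T b ℕ.* T c) % q)) % q ≡⟨ cong (λ r → (T a ℕ.* r) % q) (toℕ-mod _) ⟨
    (T a ℕ.* T (b ⊗ c)) % q         ∎)
    where open ≡-Reasoning

  +q-comm : ∀ a b → a ⊕ b ≡ b ⊕ a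
  +q-comm a b = cong (_mod q) (ℕP.+-comm (T a) (T b))

  *q-comm : ∀ a b → a ⊗ b ≡ b ⊗ a
  *q-comm a b = cong (_mod q) (ℕP.*-comm (T a) (T b))

  +q-identityˡ : ∀ a → 𝟘 ⊕ a ≡ a
  +q-identityˡ a = trans (mod-cong (trans (cong (λ r → (r ℕ.+ T a) % q) (toℕ-mod 0)) (%-absorbˡ-+ 0 (T a)))) (mod-toℕ a)

  *q-identityˡ : ∀ a → 𝟙 ⊗ a ≡ a
  *q-identityˡ a = trans (mod-cong (begin
    (T 𝟙 ℕ.* T a) % q       ≡⟨ cong (λ r → (r ℕ.* T a) % q) (toℕ-mod 1) ⟩
    (1 % q ℕ.* T a) % q     ≡⟨ %-absorbˡ-* 1 (T a) ⟩
    (1 ℕ.* T a) % q         ≡⟨ cong (_% q) (ℕP.*-identityˡ (T a)) ⟩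
    T a % q                 ∎)) (mod-toℕ a)
    where open ≡-Reasoning

  +q-inverseʳ : ∀ a → a ⊕ - a ≡ 𝟘
  +q-inverseʳ a = mod-cong (begin
    (T a ℕ.+ T ((q ℕ.∸ T a) mod q)) % q ≡⟨ cong (λ r → (T a ℕ.+ r) % q) (toℕ-mod _) ⟩
    (T a ℕ.+ (q ℕ.∸ T a) % q) % q       ≡⟨ %-absorbʳ-+ _ _ ⟩
    (T a ℕ.+ (q ℕ.∸ T a)) % q           ≡⟨ cong (_% q) (ℕP.m+[n∸m]≡n (ℕP.<⇒≤ (toℕ<n a))) ⟩
    q % q                               ≡⟨ n%n≡0 q ⟩
    0                                   ≡⟨ m<n⇒m%n≡m (ℕ.>-nonZero⁻¹ q) ⟨
    0 % q                               ∎)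
    where open ≡-Reasoning

  *q-distribˡ-+q : ∀ a b c → a ⊗ (b ⊕ c) ≡ a ⊗ b ⊕ a ⊗ c
  *q-distribˡ-+q a b c = mod-cong (begin
    (T a ℕ.* T (b ⊕ c)) % q                      ≡⟨ cong (λ r → (T a ℕ.* r) % q) (toℕ-mod _) ⟩
    (T a ℕ.* ((T b ℕ.+ T c) % q)) % q            ≡⟨ %-absorbʳ-* (T a) _ ⟩
    (T a ℕ.* (T b ℕ.+ T c)) % q                  ≡⟨ cong (_% q) (ℕP.*-distribˡ-+ (T a) (T b) (T c)) ⟩
    (T a ℕ.* T b ℕ.+ T a ℕ.* T c) % q            ≡⟨ %-absorbˡ-+ _ _ ⟨
    ((T a ℕ.* T b) % q ℕ.+ T a ℕ.* T c) % q      ≡⟨ %-absorbʳ-+ _ _ ⟨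
    ((T a ℕ.* T b) % q ℕ.+ (T a ℕ.* T c) % q) % q ≡⟨ cong₂ (λ r s → (r ℕ.+ s) % q) (toℕ-mod _) (toℕ-mod _) ⟨
    (T (a ⊗ b) ℕ.+ T (a ⊗ c)) % q                ∎)
    where open ≡-Reasoning

  ℤq-commutativeRing : CommutativeRing _ _
  ℤq-commutativeRing = record
    { Carrier = Zq q ; _≈_ = _≡_ ; _+_ = _⊕_ ; _*_ = _⊗_ ; -_ = -_ ; 0# = 𝟘 ; 1# = 𝟙
    ; isCommutativeRing = record
      { isRing = record
        { +-isAbelianGroup = record
          { isGroup = record
            { isMonoid = record
              { isSemigroup = record
                { isMagma = record { isEquivalence = isEquivalence ; ∙-cong = cong₂ _⊕_ }
                ; assoc = +q-assoc }
              ; identity = +q-identityˡ , λ a → trans (+q-comm a _) (+q-identityˡ a) }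
            ; inverse = (λ a → trans (+q-comm _ a) (+q-inverseʳ a)) , +q-inverseʳ
            ; ⁻¹-cong = cong -_ }
          ; comm = +q-comm }
        ; *-cong = cong₂ _⊗_
        ; *-assoc = *q-assoc
        ; *-identity = *q-identityˡ , λ a → trans (*q-comm a _) (*q-identityˡ a)
        ; distrib = *q-distribˡ-+q
                  , λ a b c → trans (*q-comm _ a) (trans (*q-distribˡ-+q a b c) (cong₂ _⊕_ (*q-comm a b) (*q-comm a c))) }
      ; *-comm = *q-comm } }


  private
    module ℤq = CommutativeRing ℤq-commutativeRing
    module ℤq+ = AbelianGroupProperties ℤq.+-abelianGroup
    module ℤq+ᶜ = CommSemigroupProperties ℤq.+-commutativeSemigroup

  ⊖-⊕-cancel : ∀ b k → (b ⊖ k) ⊕ k ≡ b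
  ⊖-⊕-cancel b k = trans (ℤq.+-assoc b (- k) k) (trans (cong (b ⊕_) (ℤq.-‿inverseˡ k)) (ℤq.+-identityʳ b))

  ⊕-⊖-cancel : ∀ a k → (a ⊕ k) ⊖ k ≡ a
  ⊕-⊖-cancel a k = trans (ℤq.+-assoc a k (- k)) (trans (cong (a ⊕_) (ℤq.-‿inverseʳ k)) (ℤq.+-identityʳ a))

  ⊖-⊖-self : ∀ y z → y ⊖ (y ⊖ z) ≡ z
  ⊖-⊖-self y z = begin
    y ⊕ - (y ⊖ z)  ≡⟨ cong (y ⊕_) (ℤq+.⁻¹-anti-homo‿- y z) ⟩
    y ⊕ (z ⊖ y)    ≡⟨ ℤq.+-assoc y z (- y) ⟨
    (y ⊕ z) ⊖ y    ≡⟨ ℤq+.xyx⁻¹≈y y z ⟩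
    z              ∎
    where open ≡-Reasoning

  ≡-⊖⇒⊕-≡ : ∀ {a b k} → a ≡ b ⊖ k → a ⊕ k ≡ b
  ≡-⊖⇒⊕-≡ {a} {b} {k} a≡b⊖k = trans (cong (_⊕ k) a≡b⊖k) (⊖-⊕-cancel b k)

  ⊕-≡⇒≡-⊖ : ∀ {a b k} → a ⊕ k ≡ b → a ≡ b ⊖ k
  ⊕-≡⇒≡-⊖ {a} {b} {k} a⊕k≡b = trans (sym (⊕-⊖-cancel a k)) (cong (_⊖ k) a⊕k≡b)

  twist-identity : ∀ x p r c → (x ⊖ (p ⊕ r)) ⊕ (r ⊕ c) ≡ (x ⊕ c) ⊖ p
  twist-identity x p r c = begin
    (x ⊕ - (p ⊕ r)) ⊕ (r ⊕ c)        ≡⟨ cong (λ s → (x ⊕ s) ⊕ (r ⊕ c)) (ℤq+.⁻¹-∙-comm p r) ⟨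
    (x ⊕ (- p ⊕ - r)) ⊕ (r ⊕ c)      ≡⟨ rearrange x c (- p) r (- r) ⟩
    ((x ⊕ c) ⊖ p) ⊕ (r ⊖ r)          ≡⟨ cong (((x ⊕ c) ⊖ p) ⊕_) (ℤq.-‿inverseʳ r) ⟩
    ((x ⊕ c) ⊖ p) ⊕ 𝟘                ≡⟨ ℤq.+-identityʳ _ ⟩
    (x ⊕ c) ⊖ p                      ∎
    where
    open ≡-Reasoning
    open CommMonoidSolver ℤq.+-commutativeMonoid using (solve; _⊜_) renaming (_⊕_ to _+′_)
    rearrange : ∀ x c p′ r r′ → (x ⊕ (p′ ⊕ r′)) ⊕ (r ⊕ c) ≡ ((x ⊕ c) ⊕ p′) ⊕ (r ⊕ r′)
    rearrange = solve 5 (λ x c p′ r r′ → (x +′ (p′ +′ r′)) +′ (r +′ c) ⊜ ((x +′ c) +′ p′) +′ (r +′ r′)) refl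

  twist-to : ∀ {x p r c t} → x ⊖ (p ⊕ r) ≡ t ⊖ (r ⊕ c) → (x ⊕ c) ⊖ p ≡ t
  twist-to {x} {p} {r} {c} e = trans (sym (twist-identity x p r c)) (≡-⊖⇒⊕-≡ e)

  twist-from : ∀ {x p r c t} → (x ⊕ c) ⊖ p ≡ t → x ⊖ (p ⊕ r) ≡ t ⊖ (r ⊕ c)
  twist-from {x} {p} {r} {c} e = ⊕-≡⇒≡-⊖ (trans (twist-identity x p r c) e)

  private
    𝕍 : ℕ → Set
    𝕍 = V q
    infixl 6 _+ᵥ_
    infixr 7 _*ᵥ_
    infix  7 _·_
    _+ᵥ_ : ∀ {n} → 𝕍 n → 𝕍 n → 𝕍 n
    _+ᵥ_ = _+v_ q
    _*ᵥ_ : ∀ {n} → Zq q → 𝕍 n → 𝕍 n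
    _*ᵥ_ = _·v_ q
    _·_ : ∀ {n} → 𝕍 n → 𝕍 n → Zq q
    _·_ = dot q
    𝟎 : ∀ {n} → 𝕍 n
    𝟎 = 0v q
    -ᵥ_ : ∀ {n} → 𝕍 n → 𝕍 n
    -ᵥ_ = Vec.map -_

  +ᵥ-identityˡ : ∀ {n} (x : 𝕍 n) → 𝟎 +ᵥ x ≡ x
  +ᵥ-identityˡ []      = refl
  +ᵥ-identityˡ (a ∷ x) = cong₂ _∷_ (ℤq.+-identityˡ a) (+ᵥ-identityˡ x)

  -ᵥ-⊕-cancel : ∀ {n} (x w : 𝕍 n) → (x +ᵥ -ᵥ w) +ᵥ w ≡ x
  -ᵥ-⊕-cancel []      []      = refl
  -ᵥ-⊕-cancel (a ∷ x) (b ∷ w) = cong₂ _∷_ (⊖-⊕-cancel a b) (-ᵥ-⊕-cancel x w)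

  +ᵥ-⊖-cancel : ∀ {n} (x w : 𝕍 n) → (x +ᵥ w) +ᵥ -ᵥ w ≡ x
  +ᵥ-⊖-cancel []      []      = refl
  +ᵥ-⊖-cancel (a ∷ x) (b ∷ w) = cong₂ _∷_ (⊕-⊖-cancel a b) (+ᵥ-⊖-cancel x w)

  *ᵥ-zeroˡ : ∀ {n} (x : 𝕍 n) → 𝟘 *ᵥ x ≡ 𝟎
  *ᵥ-zeroˡ []      = refl
  *ᵥ-zeroˡ (a ∷ x) = cong₂ _∷_ (ℤq.zeroˡ a) (*ᵥ-zeroˡ x)

  *ᵥ-zeroʳ : ∀ {n} (c : Zq q) → c *ᵥ 𝟎 {n} ≡ 𝟎
  *ᵥ-zeroʳ {zero}  c = refl
  *ᵥ-zeroʳ {suc n} c = cong₂ _∷_ (ℤq.zeroʳ c) (*ᵥ-zeroʳ c)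

  dot-zeroˡ : ∀ {n} (x : 𝕍 n) → 𝟎 · x ≡ 𝟘
  dot-zeroˡ []      = refl
  dot-zeroˡ (a ∷ x) = trans (cong₂ _⊕_ (ℤq.zeroˡ a) (dot-zeroˡ x)) (ℤq.+-identityˡ 𝟘)

  dot-comm : ∀ {n} (x y : 𝕍 n) → x · y ≡ y · x
  dot-comm []      []      = refl
  dot-comm (a ∷ x) (b ∷ y) = cong₂ _⊕_ (ℤq.*-comm a b) (dot-comm x y)

  dot-+ˡ : ∀ {n} (x y z : 𝕍 n) → (x +ᵥ y) · z ≡ x · z ⊕ y · z
  dot-+ˡ []      []      []      = sym (ℤq.+-identityˡ 𝟘)
  dot-+ˡ (a ∷ x) (b ∷ y) (c ∷ z) = begin
    (a ⊕ b) ⊗ c ⊕ (x +ᵥ y) · z          ≡⟨ cong₂ _⊕_ (ℤq.distribʳ c a b) (dot-+ˡ x y z) ⟩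
    (a ⊗ c ⊕ b ⊗ c) ⊕ (x · z ⊕ y · z)   ≡⟨ ℤq+ᶜ.interchange (a ⊗ c) (b ⊗ c) (x · z) (y · z) ⟩
    (a ⊗ c ⊕ x · z) ⊕ (b ⊗ c ⊕ y · z)   ∎
    where open ≡-Reasoning

  dot-+ʳ : ∀ {n} (x y z : 𝕍 n) → x · (y +ᵥ z) ≡ x · y ⊕ x · z
  dot-+ʳ x y z = trans (dot-comm x (y +ᵥ z)) (trans (dot-+ˡ y z x) (cong₂ _⊕_ (dot-comm y x) (dot-comm z x)))

  dot-*ˡ : ∀ {n} (c : Zq q) (x z : 𝕍 n) → (c *ᵥ x) · z ≡ c ⊗ (x · z)
  dot-*ˡ c []      []      = sym (ℤq.zeroʳ c)
  dot-*ˡ c (a ∷ x) (b ∷ z) = trans (cong₂ _⊕_ (ℤq.*-assoc c a b) (dot-*ˡ c x z)) (sym (ℤq.distribˡ c (a ⊗ b) (x · z)))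

  dot-injective : ∀ {n} (a b : 𝕍 n) → (∀ y → y · a ≡ y · b) → a ≡ b
  dot-injective []      []      same = refl
  dot-injective (a ∷ x) (b ∷ z) same = cong₂ _∷_ heads (dot-injective x z tails)
    where
    head : ∀ c (v : 𝕍 _) → (𝟙 ∷ 𝟎) · (c ∷ v) ≡ c
    head c v = trans (cong₂ _⊕_ (ℤq.*-identityˡ c) (dot-zeroˡ v)) (ℤq.+-identityʳ c)
    heads : a ≡ b
    heads = trans (sym (head a x)) (trans (same (𝟙 ∷ 𝟎)) (head b z))
    tail : ∀ c (v : 𝕍 _) y → (𝟘 ∷ y) · (c ∷ v) ≡ y · v
    tail c v y = trans (cong (_⊕ y · v) (ℤq.zeroˡ c)) (ℤq.+-identityˡ (y · v))
    tails : ∀ y → y · x ≡ y · z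
    tails y = trans (sym (tail a x y)) (trans (same (𝟘 ∷ y)) (tail b z y))

  LinearFunctional : ∀ {n} → (𝕍 n → Zq q) → Set
  LinearFunctional ℓ = (∀ x y → ℓ (x +ᵥ y) ≡ ℓ x ⊕ ℓ y) × (∀ c x → ℓ (c *ᵥ x) ≡ c ⊗ ℓ x)

  representative : ∀ {n} → (𝕍 n → Zq q) → 𝕍 n
  representative {zero}  ℓ = []
  representative {suc n} ℓ = ℓ (𝟙 ∷ 𝟎) ∷ representative (λ x → ℓ (𝟘 ∷ x))

  representative-dot : ∀ {n} (ℓ : 𝕍 n → Zq q) → LinearFunctional ℓ → ∀ v → ℓ v ≡ v · representative ℓ
  representative-dot {zero}  ℓ (additive , homogeneous) [] = begin
    ℓ []           ≡⟨ cong ℓ (*ᵥ-zeroˡ []) ⟨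
    ℓ (𝟘 *ᵥ [])    ≡⟨ homogeneous 𝟘 [] ⟩
    𝟘 ⊗ ℓ []       ≡⟨ ℤq.zeroˡ (ℓ []) ⟩
    𝟘              ∎
    where open ≡-Reasoning
  representative-dot {suc n} ℓ (additive , homogeneous) (a ∷ x) = begin
    ℓ (a ∷ x)                                    ≡⟨ cong ℓ split ⟨
    ℓ (a *ᵥ (𝟙 ∷ 𝟎) +ᵥ (𝟘 ∷ x))                  ≡⟨ additive _ _ ⟩
    ℓ (a *ᵥ (𝟙 ∷ 𝟎)) ⊕ ℓ (𝟘 ∷ x)
      ≡⟨ cong₂ _⊕_ (homogeneous a (𝟙 ∷ 𝟎)) (representative-dot ℓ′ ℓ′-linear x) ⟩
    a ⊗ ℓ (𝟙 ∷ 𝟎) ⊕ x · representative ℓ′       ∎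
    where
    open ≡-Reasoning
    ℓ′ : 𝕍 n → Zq q
    ℓ′ y = ℓ (𝟘 ∷ y)
    split : a *ᵥ (𝟙 ∷ 𝟎) +ᵥ (𝟘 ∷ x) ≡ a ∷ x
    split = cong₂ _∷_ (trans (ℤq.+-identityʳ (a ⊗ 𝟙)) (ℤq.*-identityʳ a))
                      (trans (cong (_+ᵥ x) (*ᵥ-zeroʳ a)) (+ᵥ-identityˡ x))
    ℓ′-linear : LinearFunctional ℓ′
    ℓ′-linear = (λ y z → trans (cong (λ c → ℓ (c ∷ y +ᵥ z)) (sym (ℤq.+-identityˡ 𝟘))) (additive (𝟘 ∷ y) (𝟘 ∷ z)))
              , (λ c y → trans (cong (λ d → ℓ (d ∷ c *ᵥ y)) (sym (ℤq.zeroʳ c))) (homogeneous c (𝟘 ∷ y)))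

  linear-zero : ∀ {n} (L : 𝕍 n → 𝕍 n) → Linear q L → L 𝟎 ≡ 𝟎
  linear-zero L (_ , homogeneous) = begin
    L 𝟎           ≡⟨ cong L (*ᵥ-zeroˡ 𝟎) ⟨
    L (𝟘 *ᵥ 𝟎)    ≡⟨ homogeneous 𝟘 𝟎 ⟩
    𝟘 *ᵥ L 𝟎      ≡⟨ *ᵥ-zeroˡ (L 𝟎) ⟩
    𝟎             ∎
    where open ≡-Reasoning

  inverse-linear : ∀ {n} (L M : 𝕍 n → 𝕍 n) → Linear q L → (∀ x → M (L x) ≡ x) → (∀ y → L (M y) ≡ y) → Linear q M
  inverse-linear L M (additive , homogeneous) ML LM =
      (λ x y → begin
        M (x +ᵥ y)             ≡⟨ cong M (cong₂ _+ᵥ_ (LM x) (LM y)) ⟨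
        M (L (M x) +ᵥ L (M y)) ≡⟨ cong M (additive (M x) (M y)) ⟨
        M (L (M x +ᵥ M y))     ≡⟨ ML _ ⟩
        M x +ᵥ M y             ∎)
    , (λ c x → begin
        M (c *ᵥ x)             ≡⟨ cong (λ y → M (c *ᵥ y)) (LM x) ⟨
        M (c *ᵥ L (M x))       ≡⟨ cong M (homogeneous c (M x)) ⟨
        M (L (c *ᵥ M x))       ≡⟨ ML _ ⟩
        c *ᵥ M x               ∎)
    where open ≡-Reasoning

  adjoint : ∀ {n} → (𝕍 n → 𝕍 n) → 𝕍 n → 𝕍 n
  adjoint L x = representative (λ v → L v · x)

  adjoint-dot : ∀ {n} (L : 𝕍 n → 𝕍 n) → Linear q L → ∀ v x → L v · x ≡ v · adjoint L x
  adjoint-dot L (additive , homogeneous) v x = representative-dot (λ u → L u · x) linear v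
    where
    linear : LinearFunctional (λ u → L u · x)
    linear = (λ y z → trans (cong (_· x) (additive y z)) (dot-+ˡ (L y) (L z) x))
           , (λ c y → trans (cong (_· x) (homogeneous c y)) (dot-*ˡ c (L y) x))

  -- Taking adjoints reverses composition, so  M ∘ L = id  gives  L* ∘ M* = id.
  adjoint-inverse : ∀ {n} (L M : 𝕍 n → 𝕍 n) → Linear q L → Linear q M →
                    (∀ x → M (L x) ≡ x) → ∀ y → adjoint L (adjoint M y) ≡ y
  adjoint-inverse L M linL linM ML y = dot-injective _ _ λ z → begin
    z · adjoint L (adjoint M y)   ≡⟨ adjoint-dot L linL z _ ⟨
    L z · adjoint M y             ≡⟨ adjoint-dot M linM (L z) y ⟨
    M (L z) · y                   ≡⟨ cong (_· y) (ML z) ⟩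
    z · y                         ∎
    where open ≡-Reasoning

  private
    _≟ᵥ_ : ∀ {n} → DecidableEquality (𝕍 n)
    _≟ᵥ_ = ≡-dec _≟F_
    δᵥ : ∀ {n} → 𝕍 n → 𝕍 n → ℤ
    δᵥ = δ _≟ᵥ_

  δᵥ-∷ : ∀ {n} a (x : 𝕍 n) b y → δᵥ (a ∷ x) (b ∷ y) ≡ δ _≟F_ a b *ℤ δᵥ x y
  δᵥ-∷ a x b y = by-cases (a ≟F b)
    where
    open ≡-Reasoning
    by-cases : Dec (a ≡ b) → δᵥ (a ∷ x) (b ∷ y) ≡ δ _≟F_ a b *ℤ δᵥ x y
    by-cases (yes refl) = begin
      δᵥ (a ∷ x) (a ∷ y)          ≡⟨ δ-⇔ _≟ᵥ_ _≟ᵥ_ (proj₂ ∘ ∷-injective) (cong (a ∷_)) ⟩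
      δᵥ x y                      ≡⟨ ℤP.*-identityˡ (δᵥ x y) ⟨
      1ℤ *ℤ δᵥ x y                ≡⟨ cong (_*ℤ δᵥ x y) (δ-≡ _≟F_ {a} refl) ⟨
      δ _≟F_ a a *ℤ δᵥ x y        ∎
    by-cases (no a≢b) = begin
      δᵥ (a ∷ x) (b ∷ y)          ≡⟨ δ-≢ _≟ᵥ_ (a≢b ∘ proj₁ ∘ ∷-injective) ⟩
      0ℤ                          ≡⟨ ℤP.*-zeroˡ (δᵥ x y) ⟨
      0ℤ *ℤ δᵥ x y                ≡⟨ cong (_*ℤ δᵥ x y) (δ-≢ _≟F_ a≢b) ⟨
      δ _≟F_ a b *ℤ δᵥ x y        ∎

  sift-V : ∀ n (z : 𝕍 n) (K : 𝕍 n → ℤ) → ∑ (allV q n) (λ y → δᵥ z y *ℤ K y) ≡ K z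
  sift-V zero    [] K = trans (ℤP.+-identityʳ _) (trans (cong (_*ℤ K []) (δ-≡ _≟ᵥ_ {a = []} refl)) (ℤP.*-identityˡ (K [])))
  sift-V (suc n) (b ∷ z) K = begin
    ∑ (concatMap (λ a → List.map (a ∷_) (allV q n)) (allFin q)) (λ y → δᵥ (b ∷ z) y *ℤ K y)
      ≡⟨ ∑-concatMap (λ a → List.map (a ∷_) (allV q n)) (allFin q) _ ⟩
    ∑ (allFin q) (λ a → ∑ (List.map (a ∷_) (allV q n)) (λ y → δᵥ (b ∷ z) y *ℤ K y))
      ≡⟨ ∑-cong (allFin q) (λ a → trans (∑-map (a ∷_) (allV q n) _) (row a)) ⟩
    ∑ (allFin q) (λ a → δ _≟F_ b a *ℤ K (a ∷ z))
      ≡⟨ sift-Fin b (λ a → K (a ∷ z)) ⟩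
    K (b ∷ z) ∎
    where
    open ≡-Reasoning
    row : ∀ a → ∑ (allV q n) (λ x → δᵥ (b ∷ z) (a ∷ x) *ℤ K (a ∷ x)) ≡ δ _≟F_ b a *ℤ K (a ∷ z)
    row a = begin
      ∑ (allV q n) (λ x → δᵥ (b ∷ z) (a ∷ x) *ℤ K (a ∷ x))
        ≡⟨ ∑-cong (allV q n) (λ x → trans (cong (_*ℤ K (a ∷ x)) (δᵥ-∷ b z a x)) (ℤP.*-assoc (δ _≟F_ b a) _ _)) ⟩
      ∑ (allV q n) (λ x → δ _≟F_ b a *ℤ (δᵥ z x *ℤ K (a ∷ x)))
        ≡⟨ ∑-*ˡ (allV q n) (δ _≟F_ b a) _ ⟩
      δ _≟F_ b a *ℤ ∑ (allV q n) (λ x → δᵥ z x *ℤ K (a ∷ x))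
        ≡⟨ cong (δ _≟F_ b a *ℤ_) (sift-V n z (λ x → K (a ∷ x))) ⟩
      δ _≟F_ b a *ℤ K (a ∷ z) ∎

  ∑-bijection : ∀ n (B B⁻¹ : 𝕍 n → 𝕍 n) → (∀ x → B⁻¹ (B x) ≡ x) → (∀ y → B (B⁻¹ y) ≡ y) →
                ∀ (G : 𝕍 n → ℤ) → ∑ (allV q n) (λ y → G (B y)) ≡ ∑ (allV q n) G
  ∑-bijection n B B⁻¹ B⁻¹B BB⁻¹ G = begin
    ∑ E (λ y → G (B y))                          ≡⟨ ∑-cong E (λ y → sift-V n (B y) G) ⟨
    ∑ E (λ y → ∑ E (λ x → δᵥ (B y) x *ℤ G x))    ≡⟨ ∑-swap E E _ ⟩
    ∑ E (λ x → ∑ E (λ y → δᵥ (B y) x *ℤ G x))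
      ≡⟨ ∑-cong E (λ x → ∑-cong E (λ y → cong (_*ℤ G x) (B-delta x y))) ⟩
    ∑ E (λ x → ∑ E (λ y → δᵥ (B⁻¹ x) y *ℤ G x))  ≡⟨ ∑-cong E (λ x → sift-V n (B⁻¹ x) (λ _ → G x)) ⟩
    ∑ E G                                         ∎
    where
    open ≡-Reasoning
    E = allV q n
    B-delta : ∀ x y → δᵥ (B y) x ≡ δᵥ (B⁻¹ x) y
    B-delta x y = δ-⇔ _≟ᵥ_ _≟ᵥ_ (λ By≡x → trans (cong B⁻¹ (sym By≡x)) (B⁻¹B y))
                                 (λ B⁻¹x≡y → trans (cong B (sym B⁻¹x≡y)) (BB⁻¹ x))

  sumZ-∑ : {A : Set} (G : A → ℤ) (xs : List A) → sumZ q (List.map G xs) ≡ ∑ xs G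
  sumZ-∑ G []       = refl
  sumZ-∑ G (x ∷ xs) = cong (G x +ℤ_) (sumZ-∑ G xs)

  sumC-coefficient : {A : Set} (c : A → C q) (xs : List A) (t : Zq q) →
                     sumC q (List.map c xs) t ≡ ∑ xs (λ x → c x t)
  sumC-coefficient c []       t = refl
  sumC-coefficient c (x ∷ xs) t = cong (c x t +ℤ_) (sumC-coefficient c xs t)

  χ-δ : ∀ a b → χ q a b ≡ δ _≟F_ a b
  χ-δ a b with a ≟F b
  ... | yes _ = refl
  ... | no  _ = refl

  χ-shift : ∀ a (d : C q) t → _*C_ q (χ q a) d t ≡ d (t ⊖ a)
  χ-shift a d t = begin
    sumZ q (List.map (λ b → χ q a b *ℤ d (t ⊖ b)) (allFin q))
      ≡⟨ sumZ-∑ _ (allFin q) ⟩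
    ∑ (allFin q) (λ b → χ q a b *ℤ d (t ⊖ b))
      ≡⟨ ∑-cong (allFin q) (λ b → cong (_*ℤ d (t ⊖ b)) (χ-δ a b)) ⟩
    ∑ (allFin q) (λ b → δ _≟F_ a b *ℤ d (t ⊖ b))
      ≡⟨ sift-Fin a (λ b → d (t ⊖ b)) ⟩
    d (t ⊖ a) ∎
    where open ≡-Reasoning

  wht-coefficient : ∀ {n} (g : F q n) (u : 𝕍 n) t → wht q g u t ≡ ∑ (allV q n) (λ x → δ _≟F_ (g x ⊖ u · x) t)
  wht-coefficient {n} g u t = begin
    wht q g u t
      ≡⟨ sumC-coefficient term (allV q n) t ⟩
    ∑ (allV q n) (λ x → term x t)
      ≡⟨ ∑-cong (allV q n) (λ x → χ-shift (g x) (conj q (χ q (u · x))) t) ⟩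
    ∑ (allV q n) (λ x → χ q (u · x) (- (t ⊖ g x)))
      ≡⟨ ∑-cong (allV q n) (λ x → χ-δ (u · x) _) ⟩
    ∑ (allV q n) (λ x → δ _≟F_ (u · x) (- (t ⊖ g x)))
      ≡⟨ ∑-cong (allV q n) (λ x → δ-⇔ _≟F_ _≟F_ to from) ⟩
    ∑ (allV q n) (λ x → δ _≟F_ (g x ⊖ u · x) t) ∎
    where
    open ≡-Reasoning
    term : 𝕍 n → C q
    term x = _*C_ q (χ q (g x)) (conj q (χ q (u · x)))
    to : ∀ {m G} → m ≡ - (t ⊖ G) → G ⊖ m ≡ t
    to {m} {G} m≡ = trans (cong (G ⊖_) (trans m≡ (ℤq+.⁻¹-anti-homo‿- t G))) (⊖-⊖-self G t)
    from : ∀ {m G} → G ⊖ m ≡ t → m ≡ - (t ⊖ G)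
    from {m} {G} G⊖m≡t = trans (sym (⊖-⊖-self G m)) (trans (cong (G ⊖_) G⊖m≡t) (sym (ℤq+.⁻¹-anti-homo‿- t G)))

  -- The change of variables that untwists a transform: for L linear with inverse M,
  -- untwist y = M*(y + w) is a bijection of V_n (inverse retwist x = L* x − w) under which
  -- the frequency L v becomes v, up to the constant v·w.
  module Untwist {n} (L M : 𝕍 n → 𝕍 n) (linL : Linear q L) (linM : Linear q M)
                 (ML : ∀ x → M (L x) ≡ x) (LM : ∀ y → L (M y) ≡ y) (w : 𝕍 n) where

    untwist retwist : 𝕍 n → 𝕍 n
    untwist y = adjoint M (y +ᵥ w)
    retwist x = adjoint L x +ᵥ -ᵥ w

    retwist-untwist : ∀ y → retwist (untwist y) ≡ y
    retwist-untwist y = trans (cong (_+ᵥ -ᵥ w) (adjoint-inverse L M linL linM ML (y +ᵥ w))) (+ᵥ-⊖-cancel y w)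

    untwist-retwist : ∀ x → untwist (retwist x) ≡ x
    untwist-retwist x = trans (cong (adjoint M) (-ᵥ-⊕-cancel (adjoint L x) w)) (adjoint-inverse M L linM linL LM x)

    untwist-frequency : ∀ v y → L v · untwist y ≡ v · y ⊕ v · w
    untwist-frequency v y = begin
      L v · adjoint M (y +ᵥ w)    ≡⟨ adjoint-dot M linM (L v) (y +ᵥ w) ⟨
      M (L v) · (y +ᵥ w)          ≡⟨ cong (_· (y +ᵥ w)) (ML v) ⟩
      v · (y +ᵥ w)                ≡⟨ dot-+ʳ v y w ⟩
      v · y ⊕ v · w               ∎
      where open ≡-Reasoning

  -- Coefficientwise this is the change of variables x = untwist y in wht-coefficient.
  twisted-transform : ∀ {n} (L : 𝕍 n → 𝕍 n) → Linear q L → Invertible q L → (w : 𝕍 n) (c : Zq q) (g : F q n) →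
                      Σ (F q n) λ f → ∀ v t → _*C_ q (χ q (w · v ⊕ c)) (wht q g (L v)) t ≡ wht q f v t
  twisted-transform {n} L linL (M , ML , LM) w c g = f , coefficients
    where
    open ≡-Reasoning
    open Untwist L M linL (inverse-linear L M linL ML LM) ML LM w
    f : F q n
    f y = g (untwist y) ⊕ c
    rephase : ∀ v t y → δ _≟F_ (g (untwist y) ⊖ L v · untwist y) (t ⊖ (w · v ⊕ c)) ≡ δ _≟F_ (f y ⊖ v · y) t
    rephase v t y = begin
      δ _≟F_ (g (untwist y) ⊖ L v · untwist y) (t ⊖ (w · v ⊕ c))
        ≡⟨ cong₂ (λ a b → δ _≟F_ (g (untwist y) ⊖ a) (t ⊖ (b ⊕ c))) (untwist-frequency v y) (dot-comm w v) ⟩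
      δ _≟F_ (g (untwist y) ⊖ (v · y ⊕ v · w)) (t ⊖ (v · w ⊕ c))
        ≡⟨ δ-⇔ _≟F_ _≟F_ twist-to twist-from ⟩
      δ _≟F_ (f y ⊖ v · y) t ∎
    coefficients : ∀ v t → _*C_ q (χ q (w · v ⊕ c)) (wht q g (L v)) t ≡ wht q f v t
    coefficients v t = begin
      _*C_ q (χ q (w · v ⊕ c)) (wht q g (L v)) t
        ≡⟨ χ-shift (w · v ⊕ c) (wht q g (L v)) t ⟩
      wht q g (L v) (t ⊖ (w · v ⊕ c))
        ≡⟨ wht-coefficient g (L v) _ ⟩
      ∑ (allV q n) (λ x → δ _≟F_ (g x ⊖ L v · x) (t ⊖ (w · v ⊕ c)))
        ≡⟨ ∑-bijection n untwist retwist retwist-untwist untwist-retwist _ ⟨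
      ∑ (allV q n) (λ y → δ _≟F_ (g (untwist y) ⊖ L v · untwist y) (t ⊖ (w · v ⊕ c)))
        ≡⟨ ∑-cong (allV q n) (rephase v t) ⟩
      ∑ (allV q n) (λ y → δ _≟F_ (f y ⊖ v · y) t)
        ≡⟨ wht-coefficient f v t ⟨
      wht q f v t ∎

  -- Equality ≈C of group-ring elements: c ≈C d says that the element c − d is killed by
  -- annihilate primesDividing, i.e. by multiplication with Π_p (ζ^(q/p) − 1).
  annihilate : List ℕ → C q → C q
  annihilate ps e = List.foldr (λ p d → shiftDiff q (cofactor q p) d) e ps

  annihilate-zero : ∀ ps (e : C q) → (∀ t → e t ≡ 0ℤ) → ∀ a → annihilate ps e a ≡ 0ℤ
  annihilate-zero []       e e≗0 a = e≗0 a
  annihilate-zero (p ∷ ps) e e≗0 a = cong₂ _-ℤ_ (annihilate-zero ps e e≗0 _) (annihilate-zero ps e e≗0 a)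

  annihilate-neg : ∀ ps (e e′ : C q) → (∀ t → e′ t ≡ -ℤ e t) → ∀ a → annihilate ps e′ a ≡ -ℤ annihilate ps e a
  annihilate-neg []       e e′ e′≗-e a = e′≗-e a
  annihilate-neg (p ∷ ps) e e′ e′≗-e a =
    trans (cong₂ _-ℤ_ (annihilate-neg ps e e′ e′≗-e _) (annihilate-neg ps e e′ e′≗-e a))
          (ℤ+ᵍ.⁻¹-∙-comm (annihilate ps e _) (-ℤ annihilate ps e a))

  ≈C-reflexive : (c d : C q) → (∀ t → c t ≡ d t) → EqC q c d
  ≈C-reflexive c d c≗d = annihilate-zero (primesDividing q) (_-C_ q c d)
                                          (λ t → trans (cong (_-ℤ d t) (c≗d t)) (ℤP.+-inverseʳ (d t)))

  ≈C-sym : (c d : C q) → EqC q c d → EqC q d c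
  ≈C-sym c d c≈d a = begin
    annihilate (primesDividing q) (_-C_ q d c) a
      ≡⟨ annihilate-neg (primesDividing q) (_-C_ q c d) (_-C_ q d c) (λ t → sym (ℤ+ᵍ.⁻¹-anti-homo‿- (c t) (d t))) a ⟩
    -ℤ annihilate (primesDividing q) (_-C_ q c d) a       ≡⟨ cong -ℤ_ (c≈d a) ⟩
    0ℤ                                                    ∎
    where open ≡-Reasoning

  twisted-line : ∀ {n} (s : 𝕍 n → C q) (L : 𝕍 n → 𝕍 n) → Linear q L → Invertible q L →
                 (ψ : 𝕍 n → Zq q) → Affine q ψ → (g : F q n) →
                 (∀ v → s v ≡ _*C_ q (χ q (ψ v)) (wht q g (L v))) →
                 Σ (F q n) λ f → ∀ v → EqC q (s v) (wht q f v)
  twisted-line {n} s L linL invL ψ (w , c , ψ-affine) g s-entries = f , λ v →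
      subst (λ e → EqC q e (wht q f v)) (sym (entry v)) (≈C-reflexive _ _ (proj₂ twisted v))
    where
    twisted : Σ (F q n) λ f → ∀ v t → _*C_ q (χ q (w · v ⊕ c)) (wht q g (L v)) t ≡ wht q f v t
    twisted = twisted-transform L linL invL w c g
    f : F q n
    f = proj₁ twisted
    entry : ∀ v → s v ≡ _*C_ q (χ q (w · v ⊕ c)) (wht q g (L v))
    entry v = trans (s-entries v) (cong (λ a → _*C_ q (χ q a) (wht q g (L v))) (ψ-affine v))

  axis-line : ∀ {n} (s : 𝕍 n → C q) (k : F q n) (e : 𝕍 n → C q) → EqC q (s 𝟎) (wht q k 𝟎) →
              (∀ v → ¬ v ≡ 𝟎 → s v ≡ e v) → (∀ v → ¬ v ≡ 𝟎 → EqC q (wht q k v) (e v)) →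
              ∀ v → EqC q (s v) (wht q k v)
  axis-line s k e origin s≡e k̂≈e v with v ≟ᵥ 𝟎
  ... | yes refl = origin
  ... | no  v≢𝟎  = subst (λ z → EqC q z (wht q k v)) (sym (s≡e v v≢𝟎)) (≈C-sym (wht q k v) (e v) (k̂≈e v v≢𝟎))

  module _ {n} (π : 𝕍 n → 𝕍 n → 𝕍 n) (g : F q n) (φ : F q (n + n)) (h : F q n) where

    Sq-origin : Sq q π g φ h 𝟎 𝟎 ≡ wht q h 𝟎
    Sq-origin with ≡-dec _≟F_ (𝟎 {n}) 𝟎
    ... | yes _   = refl
    ... | no  𝟎≢𝟎 = ⊥-elim (𝟎≢𝟎 refl)

    Sq-elsewhere : ∀ u v → ¬ u ≡ 𝟎 ⊎ ¬ v ≡ 𝟎 → Sq q π g φ h u v ≡ _*C_ q (χ q (app2 q φ u v)) (wht q g (π u v))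
    Sq-elsewhere u v off-origin with u ≟ᵥ 𝟎 | v ≟ᵥ 𝟎 | off-origin
    ... | yes u≡𝟎 | yes _     | inj₁ u≢𝟎 = ⊥-elim (u≢𝟎 u≡𝟎)
    ... | yes _   | yes v≡𝟎   | inj₂ v≢𝟎 = ⊥-elim (v≢𝟎 v≡𝟎)
    ... | yes _   | no  _     | _        = refl
    ... | no  _   | yes _     | _        = refl
    ... | no  _   | no  _     | _        = refl

    bent-rows : Bilinear q π → Nonsingular q π → SectionsAffine q {n} φ → (h′ : F q n) →
                EqC q (wht q h 𝟎) (wht q h′ 𝟎) →
                (∀ v → ¬ v ≡ 𝟎 → EqC q (wht q h′ v) (_*C_ q (χ q (app2 q φ 𝟎 v)) (wht q g 𝟎))) →
                ∀ u → Σ (F q n) λ f → ∀ v → EqC q (Sq q π g φ h u v) (wht q f v)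
    bent-rows bilinear nonsingular affine h′ ĥ𝟎≈ĥ′𝟎 ĥ′-axis u = row (u ≟ᵥ 𝟎)
      where
      entries : ∀ v → ¬ v ≡ 𝟎 → Sq q π g φ h 𝟎 v ≡ _*C_ q (χ q (app2 q φ 𝟎 v)) (wht q g 𝟎)
      entries v v≢𝟎 = trans (Sq-elsewhere 𝟎 v (inj₂ v≢𝟎))
                            (cong (λ z → _*C_ q (χ q (app2 q φ 𝟎 v)) (wht q g z)) (linear-zero (λ u → π u v) (proj₁ bilinear v)))
      row : Dec (u ≡ 𝟎) → Σ (F q n) λ f → ∀ v → EqC q (Sq q π g φ h u v) (wht q f v)
      row (yes refl) = h′ , axis-line (Sq q π g φ h 𝟎) h′ (λ v → _*C_ q (χ q (app2 q φ 𝟎 v)) (wht q g 𝟎))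
                              (subst (λ e → EqC q e (wht q h′ 𝟎)) (sym Sq-origin) ĥ𝟎≈ĥ′𝟎) entries ĥ′-axis
      row (no u≢𝟎)   = twisted-line (Sq q π g φ h u) (π u) (proj₂ bilinear u) (proj₂ nonsingular u u≢𝟎)
                                    (app2 q φ u) (proj₂ affine u) g (λ v → Sq-elsewhere u v (inj₁ u≢𝟎))

    bent-columns : Bilinear q π → Nonsingular q π → SectionsAffine q {n} φ →
                   (∀ u → ¬ u ≡ 𝟎 → EqC q (wht q h u) (_*C_ q (χ q (app2 q φ u 𝟎)) (wht q g 𝟎))) →
                   ∀ v → Σ (F q n) λ f → ∀ u → EqC q (Sq q π g φ h u v) (wht q f u)
    bent-columns bilinear nonsingular affine ĥ-axis v = column (v ≟ᵥ 𝟎)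
      where
      entries : ∀ u → ¬ u ≡ 𝟎 → Sq q π g φ h u 𝟎 ≡ _*C_ q (χ q (app2 q φ u 𝟎)) (wht q g 𝟎)
      entries u u≢𝟎 = trans (Sq-elsewhere u 𝟎 (inj₁ u≢𝟎))
                            (cong (λ z → _*C_ q (χ q (app2 q φ u 𝟎)) (wht q g z)) (linear-zero (π u) (proj₂ bilinear u)))
      column : Dec (v ≡ 𝟎) → Σ (F q n) λ f → ∀ u → EqC q (Sq q π g φ h u v) (wht q f u)
      column (yes refl) = h , axis-line (λ u → Sq q π g φ h u 𝟎) h (λ u → _*C_ q (χ q (app2 q φ u 𝟎)) (wht q g 𝟎))
                                (≈C-reflexive _ (wht q h 𝟎) (λ t → cong (λ e → e t) Sq-origin)) entries ĥ-axis
      column (no v≢𝟎)   = twisted-line (λ u → Sq q π g φ h u v) (λ u → π u v) (proj₁ bilinear v) (proj₁ nonsingular v v≢𝟎)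
                                       (λ u → app2 q φ u v) (proj₁ affine v) g (λ u → Sq-elsewhere u v (inj₂ v≢𝟎))

proposition4 : (q : ℕ) .{{_ : NonZero q}} → 2 ≤ q → (n : ℕ)
    → (π : V q n → V q n → V q n) → Bilinear q π → Nonsingular q π
    → (g : F q n) → (φ : F q (n + n)) → SectionsAffine q {n} φ
    → (h h′ : F q n)
    → EqC q (wht q h (0v q)) (wht q h′ (0v q))
    → (∀ u → ¬ (u ≡ 0v q) → EqC q (wht q h u) (mulC q (χ q (app2 q {n} φ u (0v q))) (wht q g (0v q))))
    → (∀ v → ¬ (v ≡ 0v q) → EqC q (wht q h′ v) (mulC q (χ q (app2 q {n} φ (0v q) v)) (wht q g (0v q))))
    → BentSquare q (Sq q π g φ h)
proposition4 q _ n π bilinear nonsingular g φ affine h h′ ĥ𝟎≈ĥ′𝟎 ĥ-axis ĥ′-axis =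
    bent-rows q π g φ h bilinear nonsingular affine h′ ĥ𝟎≈ĥ′𝟎 ĥ′-axis
  , bent-columns q π g φ h bilinear nonsingular affine ĥ-axis
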